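{- Let $2 \le k \le n$, let $G$ be a subgroup of $S_n$ and let $H$ be a subgroup of $S_n$ conjugate to $G$, i.e. $H = \sigma G \sigma^{ -1}$ for some $\sigma \in S_n$. Suppose there is a ${\rm PSCA}(n,k,\lambda)$ that is a union of distinct left cosets of $H$. Then there is a ${\rm PSCA}(n,k,\lambda)$ which is a union of distinct left cosets of $G$.
   Context: $S_n$ is the symmetric group on $[n]=\{1,\dots,n\}$, each permutation identified with the sequence $(x(1),\dots,x(n))$ of its values; $S_{n,k}$ is the set of sequences of $k$ distinct elements of $[n]$. Composition convention: $\pi\sigma$ means $\pi$ followed by $\sigma$. A left coset of $H$ is $\pi H = \{\pi h : h \in H\}$. A sequence $x \in S_n$ covers $y \in S_{n,k}$ if $y$ is a (not necessarily contiguous) subsequence of $x$. A ${\rm PSCA}(n,k,\lambda)$ is a multiset $P$ of elements of $S_n$ such that every $y \in S_{n,k}$ is covered by exactly $\lambda$ elements of $P$, counted with multiplicity. -}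

module Defs where

open import Data.Nat using (ℕ)
open import Data.Fin using (Fin)
import Data.Fin.Properties as FinP
open import Data.Vec using (Vec; toList; lookup; map; allFin)
open import Data.List using (List; length; filter; concatMap)
import Data.List as L
open import Data.List.Membership.Propositional using (_∈_)
open import Data.List.Relation.Unary.All using (All)
open import Data.List.Relation.Unary.Unique.Propositional using (Unique)
open import Data.List.Relation.Binary.Permutation.Propositional using (_↭_)
open import Data.List.Relation.Unary.AllPairs using (AllPairs)
open import Data.List.Relation.Binary.Sublist.Propositional using () renaming (_⊆_ to _⊑_)
import Data.List.Relation.Binary.Sublist.DecPropositional as DecSub
open import Data.Product using (Σ; ∃; _×_; _,_)
open import Relation.Binary.PropositionalEquality using (_≡_)
open import Relation.Nullary using (¬_)
open import Function.Bundles using (_⇔_)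

Seq : ℕ → ℕ → Set
Seq n k = Vec (Fin n) k

InSnk : ∀ {n k} → Seq n k → Set
InSnk y = Unique (toList y)

-- Elements of S_n are identified with their value sequences (x(1),...,x(n)).
Perm : ℕ → Set
Perm n = Seq n n

IsPerm : ∀ {n} → Perm n → Set
IsPerm x = InSnk x

idP : ∀ {n} → Perm n
idP {n} = allFin n

-- πσ = π followed by σ :  (πσ)(i) = σ(π(i)).
_·_ : ∀ {n} → Perm n → Perm n → Perm n
π · σ = map (lookup σ) π

infixl 7 _·_

Covers : ∀ {n k} → Perm n → Seq n k → Set
Covers x y = toList y ⊑ toList x

coverCount : ∀ {n k} → List (Perm n) → Seq n k → ℕ
coverCount {n} P y = length (filter (λ x → toList y ⊆? toList x) P)
  where open DecSub (FinP._≟_ {n}) using (_⊆?_)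

-- PSCA(n,k,λ): a multiset (list up to ordering) of elements of S_n such that
-- every y ∈ S_{n,k} is covered by exactly λ of them.
IsPSCA : (n k λ' : ℕ) → List (Perm n) → Set
IsPSCA n k λ' P = All IsPerm P × ((y : Seq n k) → InSnk y → coverCount P y ≡ λ')

record IsSubgroup {n : ℕ} (G : List (Perm n)) : Set where
  field
    elemsPerm : All IsPerm G
    noDup     : Unique G
    hasId     : idP ∈ G
    closed·   : ∀ {g h} → g ∈ G → h ∈ G → g · h ∈ G
    closedInv : ∀ {g} → g ∈ G → Σ (Perm n) λ g' → g' ∈ G × (g · g' ≡ idP) × (g' · g ≡ idP)

Conjugate : ∀ {n} → List (Perm n) → List (Perm n) → Set
Conjugate {n} H G =
  Σ (Perm n) λ σ → Σ (Perm n) λ σ' →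
    IsPerm σ × (σ · σ' ≡ idP) × (σ' · σ ≡ idP) ×
    (∀ h → (h ∈ H) ⇔ (Σ (Perm n) λ g → g ∈ G × (h ≡ σ · g · σ')))

leftCoset : ∀ {n} → Perm n → List (Perm n) → List (Perm n)
leftCoset π H = L.map (π ·_) H

DistinctCosets : ∀ {n} → List (Perm n) → Perm n → Perm n → Set
DistinctCosets {n} H π π' = ¬ (∀ (x : Perm n) → (x ∈ leftCoset π H) ⇔ (x ∈ leftCoset π' H))

UnionOfDistinctLeftCosets : ∀ {n} → List (Perm n) → List (Perm n) → Set
UnionOfDistinctLeftCosets {n} H P =
  Σ (List (Perm n)) λ reps →
    All IsPerm reps × AllPairs (DistinctCosets H) reps ×
    (P ↭ concatMap (λ π → leftCoset π H) reps)

module Submission where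

open import Defs
open import Data.Nat using (ℕ; _≤_; suc)
open import Data.List using (List)
open import Data.Product using (Σ; _×_)

open import Data.Bool using (true; false)
import Data.Fin.Properties as FinP
open import Data.Vec using (toList; lookup)
import Data.Vec as V
import Data.Vec.Properties as VP
open import Data.List using ([]; _∷_; length; filter; concatMap)
import Data.List as L
import Data.List.Properties as LP
open import Data.Product using (_,_)
open import Function using (_∘_; case_of_)
open import Function.Properties.Inverse using (↔⇒⇔)
open import Function.Construct.Composition using (_⇔-∘_)
open import Function.Construct.Symmetry using (⇔-sym)
open import Function.Bundles using (_⇔_; mk⇔; Equivalence)
open import Relation.Nullary using (does)
open import Relation.Unary using (Pred; Decidable)
open import Relation.Binary.PropositionalEquality
open import Data.List.Membership.Propositional using (_∈_)
open import Data.List.Membership.Propositional.Properties using (∈-map⁺; ∈-map⁻; map-∈↔)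
open import Data.List.Membership.Propositional.Properties.WithK using (unique∧set⇒bag)
open import Data.List.Relation.Binary.BagAndSetEquality using (∼bag⇒↭)
import Data.List.Relation.Unary.All as All
import Data.List.Relation.Unary.All.Properties as AllP
import Data.List.Relation.Unary.AllPairs as AllPairs
import Data.List.Relation.Unary.AllPairs.Properties as AllPairsP
open import Data.List.Relation.Unary.Unique.Propositional using (Unique)
import Data.List.Relation.Unary.Unique.Propositional.Properties as UniqueP
open import Data.List.Relation.Binary.Permutation.Propositional
  using (_↭_; ↭-refl; ↭-sym; module PermutationReasoning)
import Data.List.Relation.Binary.Permutation.Propositional.Properties as ↭P
import Data.List.Relation.Binary.Sublist.Propositional.Properties as SublistP
import Data.List.Relation.Binary.Sublist.DecPropositional as DecSublist

-- Take Q = Pσ.  Right translation by σ sends the coset πH = πσGσ⁻¹ to πσG, so a union of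
-- distinct H-cosets becomes a union of distinct G-cosets.  And xσ only renames the values of
-- x by σ, so xσ covers y exactly when x covers yσ⁻¹; as y ↦ yσ⁻¹ is a bijection of S_{n,k},
-- every y is still covered exactly λ times.

length-filter-map : ∀ {a b p} {A : Set a} {B : Set b} {P : Pred B p}
  (P? : Decidable P) (f : A → B) (xs : List A) →
  length (filter P? (L.map f xs)) ≡ length (filter (P? ∘ f) xs)
length-filter-map P? f [] = refl
length-filter-map P? f (x ∷ xs) with does (P? (f x))
... | true  = cong suc (length-filter-map P? f xs)
... | false = length-filter-map P? f xs

concatMap-↭ : ∀ {a b} {A : Set a} {B : Set b} {f g : A → List B} →
  (∀ x → f x ↭ g x) → (xs : List A) → concatMap f xs ↭ concatMap g xs
concatMap-↭ f↭g []     = ↭-refl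
concatMap-↭ f↭g (x ∷ xs) = ↭P.++⁺ (f↭g x) (concatMap-↭ f↭g xs)

module _ {n : ℕ} where

  ·-assoc : (a b c : Perm n) → (a · b) · c ≡ a · (b · c)
  ·-assoc a b c = trans (sym (VP.map-∘ (lookup c) (lookup b) a))
                        (VP.map-cong (λ i → sym (VP.lookup-map i (lookup c) b)) a)

  ·-identityˡ : (a : Perm n) → idP · a ≡ a
  ·-identityˡ = VP.map-lookup-allFin

  ·-identityʳ : (a : Perm n) → a · idP ≡ a
  ·-identityʳ a = trans (VP.map-cong VP.lookup-allFin a) (VP.map-id a)

  lookup-inverse : (σ σ' : Perm n) → σ · σ' ≡ idP → ∀ i → lookup σ' (lookup σ i) ≡ i
  lookup-inverse σ σ' σσ' i = begin
    lookup σ' (lookup σ i)   ≡⟨ VP.lookup-map i (lookup σ') σ ⟨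
    lookup (σ · σ') i        ≡⟨ cong (λ v → lookup v i) σσ' ⟩
    lookup idP i             ≡⟨ VP.lookup-allFin i ⟩
    i                        ∎
    where open ≡-Reasoning

  lookup-injective : (σ σ' : Perm n) → σ · σ' ≡ idP →
    ∀ {i j} → lookup σ i ≡ lookup σ j → i ≡ j
  lookup-injective σ σ' σσ' {i} {j} eq =
    trans (sym (lookup-inverse σ σ' σσ' i))
          (trans (cong (lookup σ') eq) (lookup-inverse σ σ' σσ' j))

  InSnk-map : ∀ {k} (σ σ' : Perm n) → σ · σ' ≡ idP →
    {y : Seq n k} → InSnk y → InSnk (V.map (lookup σ) y)
  InSnk-map σ σ' σσ' {y} uy
    rewrite VP.toList-map (lookup σ) y = UniqueP.map⁺ (lookup-injective σ σ' σσ') uy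

  Covers-relabel : ∀ {k} (τ : Perm n) {x : Perm n} {y : Seq n k} →
    Covers x y → Covers (x · τ) (V.map (lookup τ) y)
  Covers-relabel τ {x} {y} c
    rewrite VP.toList-map (lookup τ) y | VP.toList-map (lookup τ) x =
    SublistP.map⁺ (lookup τ) c

module RightTranslation {n : ℕ} (σ σ' : Perm n) (σσ' : σ · σ' ≡ idP) (σ'σ : σ' · σ ≡ idP) where

  ·-cancelʳ : ∀ {x y : Perm n} → x · σ ≡ y · σ → x ≡ y
  ·-cancelʳ {x} {y} eq = begin
    x                ≡⟨ ·-identityʳ x ⟨
    x · idP          ≡⟨ cong (x ·_) σσ' ⟨
    x · (σ · σ')     ≡⟨ ·-assoc x σ σ' ⟨
    (x · σ) · σ'     ≡⟨ cong (_· σ') eq ⟩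
    (y · σ) · σ'     ≡⟨ ·-assoc y σ σ' ⟩
    y · (σ · σ')     ≡⟨ cong (y ·_) σσ' ⟩
    y · idP          ≡⟨ ·-identityʳ y ⟩
    y                ∎
    where open ≡-Reasoning

  map-lookup-inverse : ∀ {k} (y : Seq n k) → V.map (lookup σ) (V.map (lookup σ') y) ≡ y
  map-lookup-inverse y =
    trans (sym (VP.map-∘ (lookup σ) (lookup σ') y))
          (trans (VP.map-cong (lookup-inverse σ' σ σ'σ) y) (VP.map-id y))

  Covers-·ʳ : ∀ {k} (y : Seq n k) (x : Perm n) →
    Covers (x · σ) y ⇔ Covers x (V.map (lookup σ') y)
  Covers-·ʳ y x = mk⇔
    (λ c → subst (λ z → Covers z (V.map (lookup σ') y)) xσσ'≡x (Covers-relabel σ' c))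
    (λ c → subst (Covers (x · σ)) (map-lookup-inverse y) (Covers-relabel σ c))
    where
      xσσ'≡x : (x · σ) · σ' ≡ x
      xσσ'≡x = trans (·-assoc x σ σ') (trans (cong (x ·_) σσ') (·-identityʳ x))

  coverCount-·ʳ : ∀ {k} (P : List (Perm n)) (y : Seq n k) →
    coverCount (L.map (_· σ) P) y ≡ coverCount P (V.map (lookup σ') y)
  coverCount-·ʳ P y = trans
    (length-filter-map (λ x → toList y ⊆? toList x) (_· σ) P)
    (cong length (LP.filter-≐ _ _
      ((λ {x} → Equivalence.to (Covers-·ʳ y x)) , (λ {x} → Equivalence.from (Covers-·ʳ y x))) P))
    where open DecSublist (FinP._≟_ {n}) using (_⊆?_)

  IsPerm-·ʳ : {x : Perm n} → IsPerm x → IsPerm (x · σ)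
  IsPerm-·ʳ = InSnk-map σ σ' σσ'

  IsPSCA-·ʳ : ∀ {k λ'} {P : List (Perm n)} → IsPSCA n k λ' P → IsPSCA n k λ' (L.map (_· σ) P)
  IsPSCA-·ʳ {P = P} (allPerm , count) =
    AllP.map⁺ (All.map IsPerm-·ʳ allPerm) ,
    λ y uy → trans (coverCount-·ʳ P y) (count _ (InSnk-map σ' σ σ'σ uy))

  conj : Perm n → Perm n
  conj g = σ · g · σ'

  conj-·ʳ : ∀ π g → (π · conj g) · σ ≡ (π · σ) · g
  conj-·ʳ π g = begin
    (π · ((σ · g) · σ')) · σ   ≡⟨ ·-assoc π ((σ · g) · σ') σ ⟩
    π · (((σ · g) · σ') · σ)   ≡⟨ cong (π ·_) (·-assoc (σ · g) σ' σ) ⟩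
    π · ((σ · g) · (σ' · σ))   ≡⟨ cong (λ z → π · ((σ · g) · z)) σ'σ ⟩
    π · ((σ · g) · idP)        ≡⟨ cong (π ·_) (·-identityʳ (σ · g)) ⟩
    π · (σ · g)                ≡⟨ ·-assoc π σ g ⟨
    (π · σ) · g                ∎
    where open ≡-Reasoning

  conj-injective : ∀ {g g'} → conj g ≡ conj g' → g ≡ g'
  conj-injective {g} {g'} eq = begin
    g                  ≡⟨ ·-identityˡ g ⟨
    idP · g            ≡⟨ cong (_· g) σ'σ ⟨
    (σ' · σ) · g       ≡⟨ conj-·ʳ σ' g ⟨
    (σ' · conj g) · σ  ≡⟨ cong (λ z → (σ' · z) · σ) eq ⟩
    (σ' · conj g') · σ ≡⟨ conj-·ʳ σ' g' ⟩
    (σ' · σ) · g'      ≡⟨ cong (_· g') σ'σ ⟩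
    idP · g'           ≡⟨ ·-identityˡ g' ⟩
    g'                 ∎
    where open ≡-Reasoning

  conjugate-↭ : {G H : List (Perm n)} → Unique G → Unique H →
    (∀ h → (h ∈ H) ⇔ (Σ (Perm n) λ g → g ∈ G × (h ≡ conj g))) → H ↭ L.map conj G
  conjugate-↭ uG uH H≡σGσ' = ∼bag⇒↭ (unique∧set⇒bag uH (UniqueP.map⁺ conj-injective uG)
    (λ {h} → ↔⇒⇔ (map-∈↔ conj) ⇔-∘ H≡σGσ' h))

  module _ {G H : List (Perm n)} (H↭σGσ' : H ↭ L.map conj G) where

    leftCoset-·ʳ : ∀ π → L.map (_· σ) (leftCoset π H) ↭ leftCoset (π · σ) G
    leftCoset-·ʳ π = begin
      L.map (_· σ) (L.map (π ·_) H)               ≡⟨ LP.map-∘ H ⟨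
      L.map (λ h → (π · h) · σ) H                 ↭⟨ ↭P.map⁺ _ H↭σGσ' ⟩
      L.map (λ h → (π · h) · σ) (L.map conj G)    ≡⟨ LP.map-∘ G ⟨
      L.map (λ g → (π · conj g) · σ) G            ≡⟨ LP.map-cong (conj-·ʳ π) G ⟩
      L.map ((π · σ) ·_) G                        ∎
      where open PermutationReasoning

    ∈-leftCoset-·ʳ : ∀ {π x} → x ∈ leftCoset π H ⇔ x · σ ∈ leftCoset (π · σ) G
    ∈-leftCoset-·ʳ {π} {x} = mk⇔
      (λ x∈ → ↭P.∈-resp-↭ (leftCoset-·ʳ π) (∈-map⁺ (_· σ) x∈))
      (λ xσ∈ → case ∈-map⁻ (_· σ) (↭P.∈-resp-↭ (↭-sym (leftCoset-·ʳ π)) xσ∈) of λ where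
        (y , y∈ , xσ≡yσ) → subst (_∈ leftCoset π H) (sym (·-cancelʳ xσ≡yσ)) y∈)

    DistinctCosets-·ʳ : ∀ {π π'} → DistinctCosets H π π' → DistinctCosets G (π · σ) (π' · σ)
    DistinctCosets-·ʳ distinct sameσ = distinct λ x →
      ⇔-sym ∈-leftCoset-·ʳ ⇔-∘ (sameσ (x · σ) ⇔-∘ ∈-leftCoset-·ʳ)

    UnionOfDistinctLeftCosets-·ʳ : ∀ {P} → UnionOfDistinctLeftCosets H P →
      UnionOfDistinctLeftCosets G (L.map (_· σ) P)
    UnionOfDistinctLeftCosets-·ʳ {P} (reps , allPerm , distinct , P↭) =
      L.map (_· σ) reps ,
      AllP.map⁺ (All.map IsPerm-·ʳ allPerm) ,
      AllPairsP.map⁺ (AllPairs.map DistinctCosets-·ʳ distinct) ,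
      (begin
        L.map (_· σ) P                                          ↭⟨ ↭P.map⁺ _ P↭ ⟩
        L.map (_· σ) (concatMap (λ π → leftCoset π H) reps)     ≡⟨ LP.map-concatMap _ _ reps ⟩
        concatMap (λ π → L.map (_· σ) (leftCoset π H)) reps     ↭⟨ concatMap-↭ leftCoset-·ʳ reps ⟩
        concatMap (λ π → leftCoset (π · σ) G) reps              ≡⟨ LP.concatMap-map _ _ reps ⟨
        concatMap (λ π → leftCoset π G) (L.map (_· σ) reps)     ∎)
      where open PermutationReasoning

theorem4p4 : (n k λ' : ℕ) → 2 ≤ k → k ≤ n →
    (G H : List (Perm n)) → IsSubgroup G → IsSubgroup H → Conjugate H G →
    (Σ (List (Perm n)) λ P → IsPSCA n k λ' P × UnionOfDistinctLeftCosets H P) →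
    Σ (List (Perm n)) λ Q → IsPSCA n k λ' Q × UnionOfDistinctLeftCosets G Q
theorem4p4 n k λ' _ _ G H subG subH (σ , σ' , _ , σσ' , σ'σ , H≡σGσ') (P , psca , union) =
  L.map (_· σ) P , IsPSCA-·ʳ psca , UnionOfDistinctLeftCosets-·ʳ H↭σGσ' union
  where
    open RightTranslation σ σ' σσ' σ'σ
    H↭σGσ' : H ↭ L.map conj G
    H↭σGσ' = conjugate-↭ (IsSubgroup.noDup subG) (IsSubgroup.noDup subH) H≡σGσ'
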